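{- For all integers $m\ge1$ and $k\ge2$, $B(m,k)\le \lfloor k/2\rfloor\,(m-1)+1$.
   Context: For a point $p\in\mathbb{R}^2$ write $x(p),y(p)$ for its coordinates. A finite set of points with distinct $x$-coordinates, listed as $p_1,\dots,p_n$ with $x(p_1)<\dots<x(p_n)$, is an $n$-up-run if $y(p_i)\le y(p_{i+1})$ for all $1\le i\le n-1$. The game $B_{m,k}$ ($k\ge2$): in each turn, player A chooses a value $\hat x\in(0,1)$ and then player B chooses a value $\hat y\in\{1,2,\dots,k-1\}$, forming the point $(\hat x,\hat y)$. Player A's objective is to force the set of played points to contain an $m$-up-run, and player B's is to avoid this. $B(m,k)$ denotes the minimum number of turns in which player A can force an $m$-up-run, against any play of player B. -}

module Defs where

open import Data.Nat using (ℕ; zero; suc; _≤_; _<_)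
open import Data.Rational as ℚ using (ℚ; 0ℚ; 1ℚ)
open import Data.Product using (_×_; _,_; proj₁; proj₂; ∃-syntax)
open import Data.List using (List; []; _∷_; length)
open import Data.List.Relation.Unary.All using (All)
open import Data.List.Membership.Propositional using (_∈_)
open import Data.List.Relation.Unary.Linked using (Linked)
open import Relation.Binary.PropositionalEquality using (_≡_)

Point : Set
Point = ℚ × ℕ

xc : Point → ℚ
xc = proj₁

yc : Point → ℕ
yc = proj₂

UpStep : Point → Point → Set
UpStep p q = (xc p ℚ.< xc q) × (yc p ≤ yc q)

IsUpRun : List Point → Set
IsUpRun Q = Linked UpStep Q

HasUpRun : ℕ → List Point → Set
HasUpRun m P = ∃[ Q ] (length Q ≡ m × All (_∈ P) Q × IsUpRun Q)

-- Forces m k n P : in the game B_{m,k}, starting from the set of already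
-- played points P, player A can force an m-up-run within at most n further turns.
data Forces (m k : ℕ) : ℕ → List Point → Set where
  done : ∀ {n P} → HasUpRun m P → Forces m k n P
  step : ∀ {n P} (x : ℚ) → 0ℚ ℚ.< x → x ℚ.< 1ℚ →
         (∀ (y : ℕ) → 1 ≤ y → y < k → Forces m k n ((x , y) ∷ P)) →
         Forces m k (suc n) P

B≤ : ℕ → ℕ → ℕ → Set
B≤ m k N = Forces m k N []

-- Player A keeps an open window (a , b) ⊆ (0 , 1) and always plays inside it.  The
-- heights 1 … k-1 are grouped into ⌊k/2⌋ classes, class i holding 2i+1 and 2i+2.  For
-- each class A maintains an up-run whose left part lies at x ≤ a with heights ≤ 2i+1
-- and whose right part lies at x ≥ b with heights ≥ 2i+2.  An answer 2i+1 is appended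
-- to the left part and the window shrinks to the right of the new point; an answer
-- 2i+2 is prepended to the right part and the window shrinks to its left.  Every turn
-- thus lengthens one of the ⌊k/2⌋ runs, so after ⌊k/2⌋(m-1)+1 turns one has m points.
module Submission where

open import Defs
open import Data.Nat using (ℕ; zero; suc; _≤_; _<_; _+_; _*_; _∸_; _/_; z≤n; s≤s; z<s; s<s)
open import Data.Nat.Properties as ℕ using (+-suc; ≤∧≢⇒<; <⇒≱; m<m+n; m≤m+n; <-≤-trans)
open import Data.Nat.DivMod using (m/n≡1+[m∸n]/n)
open import Data.Rational as ℚ using (ℚ; 0ℚ; 1ℚ)
import Data.Rational.Properties as ℚ
open import Data.Fin as Fin using (Fin; toℕ)
open import Data.Vec using (Vec; lookup; updateAt; replicate; sum; []; _∷_)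
open import Data.Vec.Properties using (lookup∘updateAt; lookup∘updateAt′; lookup-replicate)
open import Data.Product using (Σ-syntax; _×_; _,_; proj₁; proj₂)
open import Data.Sum using (_⊎_; inj₁; inj₂)
open import Data.List using (List; []; _∷_; _++_; [_]; length)
open import Data.List.Properties using (length-++)
open import Data.List.Relation.Unary.All as All using (All; []; _∷_)
import Data.List.Relation.Unary.All.Properties as All
open import Data.List.Relation.Unary.AllPairs using (AllPairs; []; _∷_)
import Data.List.Relation.Unary.AllPairs.Properties as AllPairs
open import Data.List.Relation.Unary.Any using (here; there)
open import Data.List.Membership.Propositional using (_∈_)
open import Data.List.Relation.Unary.Linked.Properties using (AllPairs⇒Linked)
open import Data.Empty using (⊥-elim)
open import Relation.Binary.PropositionalEquality using (_≡_; refl; sym; trans; cong; subst; module ≡-Reasoning)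
open import Relation.Nullary using (yes; no)

Below : ℚ → ℕ → Point → Set
Below a ℓ p = xc p ℚ.≤ a × yc p ≤ ℓ

Above : ℚ → ℕ → Point → Set
Above b ℓ p = b ℚ.≤ xc p × ℓ < yc p

record SplitRun (a b : ℚ) (ℓ : ℕ) (P : List Point) (n : ℕ) : Set where
  field
    left right   : List Point
    size         : length left + length right ≡ n
    left-run     : AllPairs UpStep left
    right-run    : AllPairs UpStep right
    left-below   : All (Below a ℓ) left
    right-above  : All (Above b ℓ) right
    left-played  : All (_∈ P) left
    right-played : All (_∈ P) right

module _ {a b : ℚ} {ℓ : ℕ} where

  emptySplitRun : ∀ {P} → SplitRun a b ℓ P 0
  emptySplitRun = record
    { left = [] ; right = [] ; size = refl ; left-run = [] ; right-run = []
    ; left-below = [] ; right-above = [] ; left-played = [] ; right-played = [] }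

  splitRun⇒hasUpRun : ∀ {P n} → a ℚ.< b → SplitRun a b ℓ P n → HasUpRun n P
  splitRun⇒hasUpRun {P} a<b r =
    left ++ right , trans (length-++ left) size , All.++⁺ left-played right-played ,
    AllPairs⇒Linked (AllPairs.++⁺ left-run right-run
      (All.map (λ p → All.map (cross p) right-above) left-below))
    where
    open SplitRun r
    cross : ∀ {p q} → Below a ℓ p → Above b ℓ q → UpStep p q
    cross (xp≤a , yp≤ℓ) (b≤xq , ℓ<yq) =
      ℚ.≤-<-trans xp≤a (ℚ.<-≤-trans a<b b≤xq) , ℕ.≤-trans yp≤ℓ (ℕ.<⇒≤ ℓ<yq)

  narrow : ∀ {a′ b′ P n q} → a ℚ.≤ a′ → b′ ℚ.≤ b → SplitRun a b ℓ P n → SplitRun a′ b′ ℓ (q ∷ P) n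
  narrow a≤a′ b′≤b r = record
    { left         = left
    ; right        = right
    ; size         = size
    ; left-run     = left-run
    ; right-run    = right-run
    ; left-below   = All.map (λ (xp≤a , yp≤ℓ) → ℚ.≤-trans xp≤a a≤a′ , yp≤ℓ) left-below
    ; right-above  = All.map (λ (b≤xq , ℓ<yq) → ℚ.≤-trans b′≤b b≤xq , ℓ<yq) right-above
    ; left-played  = All.map there left-played
    ; right-played = All.map there right-played }
    where open SplitRun r

  extendLeft : ∀ {x P n} → a ℚ.< x → SplitRun a b ℓ P n → SplitRun x b ℓ ((x , ℓ) ∷ P) (suc n)
  extendLeft {x} {n = n} a<x r = record
    { left         = left ++ [ x , ℓ ]
    ; right        = right
    ; size         = size′
    ; left-run     = AllPairs.++⁺ left-run ([] ∷ []) (All.map (λ p → toNewPoint p ∷ []) left-below)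
    ; right-run    = right-run
    ; left-below   = All.++⁺ (All.map (λ (xp≤a , yp≤ℓ) → ℚ.≤-trans xp≤a (ℚ.<⇒≤ a<x) , yp≤ℓ) left-below)
                             ((ℚ.≤-refl , ℕ.≤-refl) ∷ [])
    ; right-above  = right-above
    ; left-played  = All.++⁺ (All.map there left-played) (here refl ∷ [])
    ; right-played = All.map there right-played }
    where
    open SplitRun r
    toNewPoint : ∀ {p} → Below a ℓ p → UpStep p (x , ℓ)
    toNewPoint (xp≤a , yp≤ℓ) = ℚ.≤-<-trans xp≤a a<x , yp≤ℓ
    size′ : length (left ++ [ x , ℓ ]) + length right ≡ suc n
    size′ = begin
      length (left ++ [ x , ℓ ]) + length right ≡⟨ cong (_+ length right) (length-++ left) ⟩
      length left + 1 + length right            ≡⟨ ℕ.+-assoc (length left) 1 (length right) ⟩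
      length left + suc (length right)          ≡⟨ +-suc (length left) (length right) ⟩
      suc (length left + length right)          ≡⟨ cong suc size ⟩
      suc n                                     ∎
      where open ≡-Reasoning

  extendRight : ∀ {x P n} → x ℚ.< b → SplitRun a b ℓ P n → SplitRun a x ℓ ((x , suc ℓ) ∷ P) (suc n)
  extendRight {x} x<b r = record
    { left         = left
    ; right        = (x , suc ℓ) ∷ right
    ; size         = trans (+-suc (length left) (length right)) (cong suc size)
    ; left-run     = left-run
    ; right-run    = All.map (λ (b≤xq , ℓ<yq) → ℚ.<-≤-trans x<b b≤xq , ℓ<yq) right-above ∷ right-run
    ; left-below   = left-below
    ; right-above  = (ℚ.≤-refl , ℕ.≤-refl)
                     ∷ All.map (λ (b≤xq , ℓ<yq) → ℚ.≤-trans (ℚ.<⇒≤ x<b) b≤xq , ℓ<yq) right-above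
    ; left-played  = All.map there left-played
    ; right-played = here refl ∷ All.map there right-played }
    where open SplitRun r

sum-updateAt-suc : ∀ {n} (xs : Vec ℕ n) (i : Fin n) → sum (updateAt xs i suc) ≡ suc (sum xs)
sum-updateAt-suc (x ∷ xs) Fin.zero    = refl
sum-updateAt-suc (x ∷ xs) (Fin.suc i) = trans (cong (x +_) (sum-updateAt-suc xs i)) (+-suc x (sum xs))

sum≤n*bound : ∀ {n b} (xs : Vec ℕ n) → (∀ i → lookup xs i ≤ b) → sum xs ≤ n * b
sum≤n*bound []       _   = z≤n
sum≤n*bound (x ∷ xs) xs≤ = ℕ.+-mono-≤ (xs≤ Fin.zero) (sum≤n*bound xs (λ i → xs≤ (Fin.suc i)))

threshold : ∀ {t} → Fin t → ℕ
threshold i = suc (toℕ i * 2)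

data Answer (t : ℕ) : ℕ → Set where
  low  : (i : Fin t) → Answer t (threshold i)
  high : (i : Fin t) → Answer t (suc (threshold i))

answer-suc : ∀ {t y} → Answer t y → Answer (suc t) (suc (suc y))
answer-suc (low i)  = low (Fin.suc i)
answer-suc (high i) = high (Fin.suc i)

[2+n]/2≡1+n/2 : ∀ n → (2 + n) / 2 ≡ suc (n / 2)
[2+n]/2≡1+n/2 n = m/n≡1+[m∸n]/n {2 + n} (s≤s (s≤s z≤n))

answer : ∀ {k y} → 1 ≤ y → y < k → Answer (k / 2) y
answer {suc (suc k)}       {1} _ _ rewrite [2+n]/2≡1+n/2 k       = low Fin.zero
answer {suc (suc (suc k))} {2} _ _ rewrite [2+n]/2≡1+n/2 (suc k) = high Fin.zero
answer {suc (suc k)} {suc (suc (suc y))} _ (s<s (s<s y<k)) rewrite [2+n]/2≡1+n/2 k =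
  answer-suc (answer {k} (s≤s z≤n) y<k)
answer {1} {1} _ (s≤s ())
answer {1} {2} _ (s≤s ())
answer {2} {2} _ (s≤s (s≤s ()))

module Strategy (cap k : ℕ) where

  t : ℕ
  t = k / 2

  record Position (P : List Point) : Set where
    field
      a b       : ℚ
      0≤a       : 0ℚ ℚ.≤ a
      a<b       : a ℚ.< b
      b≤1       : b ℚ.≤ 1ℚ
      sizes     : Vec ℕ t
      runs      : (i : Fin t) → SplitRun a b (threshold i) P (lookup sizes i)
      sizes≤cap : (i : Fin t) → lookup sizes i ≤ cap

  Outcome : ∀ {P} → Point → Position P → Set
  Outcome {P} q pos =
    HasUpRun (suc cap) (q ∷ P)
    ⊎ Σ[ pos′ ∈ Position (q ∷ P) ] sum (Position.sizes pos′) ≡ suc (sum (Position.sizes pos))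

  start : Position []
  start = record
    { a = 0ℚ ; b = 1ℚ ; 0≤a = ℚ.≤-refl ; a<b = ℚ.positive⁻¹ 1ℚ ; b≤1 = ℚ.≤-refl
    ; sizes     = replicate t 0
    ; runs      = λ i → subst (SplitRun _ _ _ _) (sym (lookup-replicate i 0)) emptySplitRun
    ; sizes≤cap = λ i → subst (_≤ cap) (sym (lookup-replicate i 0)) z≤n }

  module _ {P} (pos : Position P) where
    open Position pos using (a; b; 0≤a; a<b; b≤1; sizes; runs; sizes≤cap)

    addToClass : ∀ {q a′ b′} → a ℚ.≤ a′ → b′ ℚ.≤ b → a′ ℚ.< b′ → (i : Fin t) →
           SplitRun a′ b′ (threshold i) (q ∷ P) (suc (lookup sizes i)) → Outcome q pos
    addToClass {q} {a′} {b′} a≤a′ b′≤b a′<b′ i run with lookup sizes i ℕ.≟ cap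
    ... | yes full    = inj₁ (splitRun⇒hasUpRun a′<b′ (subst (SplitRun _ _ _ _) (cong suc full) run))
    ... | no notFull = inj₂ (pos′ , sum-updateAt-suc sizes i)
      where
      runs′ : ∀ j → SplitRun a′ b′ (threshold j) (q ∷ P) (lookup (updateAt sizes i suc) j)
      runs′ j with j Fin.≟ i
      ... | yes refl = subst (SplitRun _ _ _ _) (sym (lookup∘updateAt j sizes)) run
      ... | no j≢i   = subst (SplitRun _ _ _ _) (sym (lookup∘updateAt′ j i j≢i sizes)) (narrow a≤a′ b′≤b (runs j))
      sizes≤cap′ : ∀ j → lookup (updateAt sizes i suc) j ≤ cap
      sizes≤cap′ j with j Fin.≟ i
      ... | yes refl rewrite lookup∘updateAt j {suc} sizes = ≤∧≢⇒< (sizes≤cap j) notFull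
      ... | no j≢i   rewrite lookup∘updateAt′ j i {suc} j≢i sizes = sizes≤cap j
      pos′ : Position (q ∷ P)
      pos′ = record
        { a = a′ ; b = b′ ; 0≤a = ℚ.≤-trans 0≤a a≤a′ ; a<b = a′<b′ ; b≤1 = ℚ.≤-trans b′≤b b≤1
        ; sizes = updateAt sizes i suc ; runs = runs′ ; sizes≤cap = sizes≤cap′ }

    probe : ℚ
    probe = proj₁ (ℚ.<-dense a<b)

    a<probe : a ℚ.< probe
    a<probe = proj₁ (proj₂ (ℚ.<-dense a<b))

    probe<b : probe ℚ.< b
    probe<b = proj₂ (proj₂ (ℚ.<-dense a<b))

    0<probe : 0ℚ ℚ.< probe
    0<probe = ℚ.≤-<-trans 0≤a a<probe

    probe<1 : probe ℚ.< 1ℚ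
    probe<1 = ℚ.<-≤-trans probe<b b≤1

    respond : ∀ y → 1 ≤ y → y < k → Outcome (probe , y) pos
    respond y 1≤y y<k with answer 1≤y y<k
    ... | low i  = addToClass (ℚ.<⇒≤ a<probe) ℚ.≤-refl probe<b i (extendLeft a<probe (runs i))
    ... | high i = addToClass ℚ.≤-refl (ℚ.<⇒≤ probe<b) a<probe i (extendRight probe<b (runs i))

  force : ∀ n {P} (pos : Position P) → t * cap < n + sum (Position.sizes pos) → Forces (suc cap) k n P
  force zero    pos budget = ⊥-elim (<⇒≱ budget (sum≤n*bound sizes sizes≤cap))
    where open Position pos using (sizes; sizes≤cap)
  force (suc n) {P} pos budget =
    step (probe pos) (0<probe pos) (probe<1 pos) (λ y 1≤y y<k → continue (respond pos y 1≤y y<k))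
    where
    open Position pos using (sizes)
    continue : ∀ {q} → Outcome q pos → Forces (suc cap) k n (q ∷ P)
    continue (inj₁ run)            = done run
    continue (inj₂ (pos′ , addToClassn)) = force n pos′ (subst (t * cap <_) budget-moves budget)
      where
      budget-moves : suc n + sum sizes ≡ n + sum (Position.sizes pos′)
      budget-moves = sym (trans (cong (n +_) addToClassn) (+-suc n (sum sizes)))

  forcesWithinBudget : Forces (suc cap) k (t * cap + 1) []
  forcesWithinBudget = force (t * cap + 1) start (<-≤-trans (m<m+n (t * cap) z<s) (m≤m+n _ _))

proposition1 : (m k : ℕ) → 1 ≤ m → 2 ≤ k → B≤ m k ((k / 2) * (m ∸ 1) + 1)
proposition1 (suc cap) k _ _ = Strategy.forcesWithinBudget cap k
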